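{- Let $\Theta$ be a saturated branch of a tableau of $\mathbf{TAB}_{\mathbf{IB}}$. If $@_i j\in\Theta$ for nominals $i,j$ with $i,j\in\mathrm{dom}(v_\Theta)$, then $v_\Theta(i)=v_\Theta(j)$.
   Context: Hybrid language: fix disjoint countably infinite sets $\mathbf{Prop}$ (propositional variables) and $\mathbf{Nom}$ (nominals). Formulas: $\varphi ::= p \mid i \mid \neg\varphi \mid \varphi\land\varphi \mid \diamondsuit\varphi \mid @_i\varphi$ with $p\in\mathbf{Prop}$, $i\in\mathbf{Nom}$; $\square\varphi$ abbreviates $\neg\diamondsuit\neg\varphi$. Tableaux of $\mathbf{TAB}_{\mathbf{IB}}$: a tableau is a well-founded tree of formulas of the form $@_i\varphi$, started from a root formula $@_i\varphi$ where $i$ does not occur in $\varphi$. Each branch (maximal path) is extended by applying the rules below as often as possible, except that nothing more is added to a branch once it is closed, or once every formula that any rule could generate already occurs on it. A branch $\Theta$ is closed if $@_i\varphi, @_i\neg\varphi\in\Theta$ for some $i,\varphi$, and is saturated if every formula that any rule could generate from it already occurs in $\Theta$. Rules (premises already on the branch, conclusions added to it): [$\neg\neg$] from $@_i\neg\neg\varphi$ add $@_i\varphi$; [$\land$] from $@_i(\varphi\land\psi)$ add $@_i\varphi$ and $@_i\psi$; [$\neg\land$] from $@_i\neg(\varphi\land\psi)$ split the branch into one branch with $@_i\neg\varphi$ and one with $@_i\neg\psi$; [$\diamondsuit$] from $@_i\diamondsuit\varphi$ add $@_i\diamondsuit j$ and $@_j\varphi$, where $j$ is a nominal not yet occurring on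 the branch, the rule is applied at most once per formula, the premise is not an accessibility formula, and (restriction $\mathcal{D}$) $i$ is a quasi-urfather on the branch; [$\neg\diamondsuit$] from $@_i\neg\diamondsuit\varphi$ and $@_i\diamondsuit j$ add $@_j\neg\varphi$; [$@$] from $@_i@_j\varphi$ add $@_j\varphi$; [$\neg@$] from $@_i\neg@_j\varphi$ add $@_j\neg\varphi$; [$\mathit{Id}$] from $@_i\varphi$ and $@_i j$ add $@_j\varphi$, provided $@_i\varphi$ is not an accessibility formula; [$\mathit{Ref}$] add $@_i i$ for any nominal $i$ occurring on the branch; [$\square_{\mathit{sym}}$] from $@_i\square\varphi$ and $@_j\diamondsuit i$ add $@_j\varphi$; ($\mathcal{I}$) for every nominal $i$ occurring on the branch add $@_i\neg\diamondsuit i$. An accessibility formula is a formula $@_i\diamondsuit j$ added by [$\diamondsuit$] with $j$ new. Auxiliary notions for a branch $\Theta$: $@_i\varphi$ is a quasi-subformula of $@_j\psi$ if $\varphi$ is a subformula of $\psi$, or $\varphi=\neg\chi$ with $\chi$ a subformula of $\psi$. $T^\Theta(i)=\{\varphi \mid @_i\varphi\in\Theta$ and $@_i\varphi$ is a quasi-subformula of the root formula$\}$. Nominals $i,j$ are twins in $\Theta$ if $T^\Theta(i)=T^\Theta(j)$. $i\prec_\Theta j$ if $j$ was introduced by applying [$\diamondsuit$] to a formula $@_i\diamondsuit\varphi$; $\prec_\Theta^*$ is its reflexive transitive closure. A nominal $i$ is a quasi-urfather on $\Theta$ if there are no twins $j\neq k$ with $j\prec_\Theta^* i$ and $k\prec_\Theta^*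 i$. The identity urfather $v_\Theta(i)$ of a nominal $i$ occurring in $\Theta$ is the earliest introduced nominal $j$ on $\Theta$ that is a twin of $i$ and a quasi-urfather on $\Theta$, if such $j$ exists; $\mathrm{dom}(v_\Theta)$ is the set of nominals $i$ for which $v_\Theta(i)$ exists. -}

module Defs where

open import Data.Nat using (ℕ; suc; _<_)
open import Data.List using (List; []; _∷_; _++_; [_]; length)
open import Data.List.Membership.Propositional using (_∈_; _∉_)
open import Data.Product using (Σ; ∃; ∃-syntax; _×_; _,_)
open import Data.Sum using (_⊎_)
open import Relation.Nullary using (¬_)
open import Relation.Binary.PropositionalEquality using (_≡_; _≢_)
open import Relation.Binary.Construct.Closure.ReflexiveTransitive using (Star)

-- Syntax.  Nom = ℕ and Prop = ℕ (two disjoint countably infinite sets,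
-- kept apart by the constructors `prop` and `nom`).

Nom : Set
Nom = ℕ

data Fm : Set where
  prop : ℕ → Fm
  nom  : Nom → Fm
  ~_   : Fm → Fm
  _∧_  : Fm → Fm → Fm
  ◇_   : Fm → Fm
  at   : Nom → Fm → Fm

infix  30 ~_ ◇_
infixr 20 _∧_

□_ : Fm → Fm
□ φ = ~ ◇ ~ φ
infix 30 □_

-- tableau formulas:  @ i φ  stands for  @_i φ
record AF : Set where
  constructor 𝕒⟨_⟩_
  field
    lab : Nom
    fm  : Fm

noms : Fm → List Nom
noms (prop p)  = []
noms (nom i)   = i ∷ []
noms (~ φ)     = noms φ
noms (φ ∧ ψ)   = noms φ ++ noms ψ
noms (◇ φ)     = noms φ
noms (at i φ)  = i ∷ noms φ

afNoms : AF → List Nom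
afNoms (𝕒⟨ i ⟩ φ) = i ∷ noms φ

data _⊑_ : Fm → Fm → Set where
  ⊑refl : ∀ {φ} → φ ⊑ φ
  ⊑~    : ∀ {φ ψ} → φ ⊑ ψ → φ ⊑ (~ ψ)
  ⊑∧ˡ   : ∀ {φ ψ χ} → φ ⊑ ψ → φ ⊑ (ψ ∧ χ)
  ⊑∧ʳ   : ∀ {φ ψ χ} → φ ⊑ χ → φ ⊑ (ψ ∧ χ)
  ⊑◇    : ∀ {φ ψ} → φ ⊑ ψ → φ ⊑ (◇ ψ)
  ⊑at   : ∀ {φ ψ i} → φ ⊑ ψ → φ ⊑ at i ψ

QuasiSub : AF → AF → Set
QuasiSub (𝕒⟨ i ⟩ φ) (𝕒⟨ j ⟩ ψ) = φ ⊑ ψ ⊎ ∃[ χ ] (φ ≡ ~ χ × χ ⊑ ψ)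

-- A branch records the set of its formulas (as a list) and the
-- log of [◇]-applications, newest first.  An entry  dia i φ j  means that
-- [◇] was applied to @_i ◇ φ, introducing the new nominal j.

record DiaApp : Set where
  constructor dia
  field
    src  : Nom
    body : Fm
    new  : Nom

record Branch : Set where
  constructor br
  field
    fms : List AF
    log : List DiaApp

open DiaApp
open Branch

Occurs : Branch → Nom → Set
Occurs Θ k = ∃[ f ] (f ∈ fms Θ × k ∈ afNoms f)

Closed : Branch → Set
Closed Θ = ∃[ i ] ∃[ φ ] (𝕒⟨ i ⟩ φ ∈ fms Θ × 𝕒⟨ i ⟩ (~ φ) ∈ fms Θ)

IsAcc : Branch → AF → Set
IsAcc Θ (𝕒⟨ i ⟩ ψ) = ∃[ d ] (d ∈ log Θ × src d ≡ i × ψ ≡ ◇ nom (new d))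

Parent : Branch → Nom → Nom → Set
Parent Θ i j = ∃[ d ] (d ∈ log Θ × src d ≡ i × new d ≡ j)

Anc : Branch → Nom → Nom → Set
Anc Θ = Star (Parent Θ)

module _ (r : AF) where
  InT : Branch → Nom → Fm → Set
  InT Θ i φ = 𝕒⟨ i ⟩ φ ∈ fms Θ × QuasiSub (𝕒⟨ i ⟩ φ) r

  Twins : Branch → Nom → Nom → Set
  Twins Θ i j = ∀ φ → (InT Θ i φ → InT Θ j φ) × (InT Θ j φ → InT Θ i φ)

  QuasiUrfather : Branch → Nom → Set
  QuasiUrfather Θ i =
    ¬ (∃[ j ] ∃[ k ] (j ≢ k × Anc Θ j i × Anc Θ k i × Twins Θ j k))

  -- non-branching rules other than [◇]; the index is the list of
  -- conclusions added to the branch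
  data Lin (Θ : Branch) : List AF → Set where
    r¬¬  : ∀ {i φ} → 𝕒⟨ i ⟩ (~ ~ φ) ∈ fms Θ → Lin Θ [ 𝕒⟨ i ⟩ φ ]
    r∧   : ∀ {i φ ψ} → 𝕒⟨ i ⟩ (φ ∧ ψ) ∈ fms Θ →
           Lin Θ (𝕒⟨ i ⟩ φ ∷ 𝕒⟨ i ⟩ ψ ∷ [])
    r¬◇  : ∀ {i j φ} → 𝕒⟨ i ⟩ (~ ◇ φ) ∈ fms Θ → 𝕒⟨ i ⟩ (◇ nom j) ∈ fms Θ →
           Lin Θ [ 𝕒⟨ j ⟩ (~ φ) ]
    r＠   : ∀ {i j φ} → 𝕒⟨ i ⟩ (at j φ) ∈ fms Θ → Lin Θ [ 𝕒⟨ j ⟩ φ ]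
    r¬＠  : ∀ {i j φ} → 𝕒⟨ i ⟩ (~ at j φ) ∈ fms Θ → Lin Θ [ 𝕒⟨ j ⟩ (~ φ) ]
    rId  : ∀ {i j φ} → 𝕒⟨ i ⟩ φ ∈ fms Θ → 𝕒⟨ i ⟩ (nom j) ∈ fms Θ →
           ¬ IsAcc Θ (𝕒⟨ i ⟩ φ) → Lin Θ [ 𝕒⟨ j ⟩ φ ]
    rRef : ∀ {i} → Occurs Θ i → Lin Θ [ 𝕒⟨ i ⟩ (nom i) ]
    r□sym : ∀ {i j φ} → 𝕒⟨ i ⟩ (□ φ) ∈ fms Θ → 𝕒⟨ j ⟩ (◇ nom i) ∈ fms Θ →
           Lin Θ [ 𝕒⟨ j ⟩ φ ]
    rI   : ∀ {i} → Occurs Θ i → Lin Θ [ 𝕒⟨ i ⟩ (~ ◇ nom i) ]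

  data Split (Θ : Branch) : AF → AF → Set where
    r¬∧ : ∀ {i φ ψ} → 𝕒⟨ i ⟩ (~ (φ ∧ ψ)) ∈ fms Θ →
          Split Θ (𝕒⟨ i ⟩ (~ φ)) (𝕒⟨ i ⟩ (~ ψ))

  record DiaApplicable (Θ : Branch) (i : Nom) (φ : Fm) : Set where
    field
      premise    : 𝕒⟨ i ⟩ (◇ φ) ∈ fms Θ
      notAcc     : ¬ IsAcc Θ (𝕒⟨ i ⟩ (◇ φ))
      notApplied : ¬ (∃[ d ] (d ∈ log Θ × src d ≡ i × body d ≡ φ))
      urfather   : QuasiUrfather Θ i

  data Step (Θ : Branch) : Branch → Set where
    lin    : ∀ {cs} → Lin Θ cs → Step Θ (br (cs ++ fms Θ) (log Θ))
    splitˡ : ∀ {a b} → Split Θ a b → Step Θ (br (a ∷ fms Θ) (log Θ))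
    splitʳ : ∀ {a b} → Split Θ a b → Step Θ (br (b ∷ fms Θ) (log Θ))
    dia◇   : ∀ {i φ j} → DiaApplicable Θ i φ → ¬ Occurs Θ j →
             Step Θ (br (𝕒⟨ j ⟩ φ ∷ 𝕒⟨ i ⟩ (◇ nom j) ∷ fms Θ)
                        (dia i φ j ∷ log Θ))

  -- saturation: every formula any rule could generate is already there
  -- (for [¬∧]: one of the two alternatives; for [◇]: the rule is no
  -- longer applicable, since it always generates a new nominal)
  Saturated : Branch → Set
  Saturated Θ =
      (∀ {cs} → Lin Θ cs → ∀ {f} → f ∈ cs → f ∈ fms Θ)
    × (∀ {a b} → Split Θ a b → a ∈ fms Θ ⊎ b ∈ fms Θ)
    × (∀ i φ → ¬ DiaApplicable Θ i φ)

  -- Θ is (an initial segment of) a branch of a tableau with root r: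
  -- rules are applied only while the branch is neither closed nor saturated
  data Reachable : Branch → Set where
    start : Reachable (br [ r ] [])
    step  : ∀ {Θ Θ'} → Reachable Θ → ¬ Closed Θ → ¬ Saturated Θ →
            Step Θ Θ' → Reachable Θ'

  -- position of a nominal in the (newest-first) [◇]-log:
  -- the n-th application (counting from 1) introduces its nominal at stage n
  data InLogAt : List DiaApp → Nom → ℕ → Set where
    here  : ∀ {d ds k} → new d ≡ k → InLogAt (d ∷ ds) k (suc (length ds))
    there : ∀ {d ds k n} → InLogAt ds k n → InLogAt (d ∷ ds) k n

  Stage : Branch → Nom → ℕ → Set
  Stage Θ k n = (k ∈ afNoms r × n ≡ 0) ⊎ InLogAt (log Θ) k n

  Earlier : Branch → Nom → Nom → Set
  Earlier Θ a b = ∃[ m ] ∃[ n ] (Stage Θ a m × Stage Θ b n ×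
                                 (m < n ⊎ (m ≡ n × a < b)))

  IsIdUrfather : Branch → Nom → Nom → Set
  IsIdUrfather Θ i j =
      Occurs Θ i
    × Occurs Θ j
    × (∃[ n ] Stage Θ j n)
    × Twins Θ i j
    × QuasiUrfather Θ j
    × (∀ k → Earlier Θ k j → ¬ (Twins Θ i k × QuasiUrfather Θ k))

{-# OPTIONS --safe #-}
-- If @_i j is on a saturated branch, [Id] copies every formula of i to j, and [Ref]
-- followed by [Id] puts @_j i on the branch, so i and j are twins. The only formulas
-- [Id] refuses to copy are accessibility formulas, and these mention a nominal
-- introduced by [◇], which never occurs in the root, so they are not counted in T^Θ.
-- The identity urfather depends only on the twin class: it is the earliest
-- quasi-urfather in it, and any two introduced nominals are comparable by "earlier".
module Submission where

open import Defs
open import Data.Nat.Properties using (<-cmp)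
open import Data.List using ([]; _∷_)
open import Data.List.Relation.Unary.Any using (here; there)
open import Data.List.Membership.Propositional using (_∈_; _∉_)
open import Data.List.Membership.Propositional.Properties using (∈-++⁺ˡ; ∈-++⁺ʳ)
open import Data.List.Relation.Binary.Subset.Propositional using (_⊆_)
open import Data.Product using (_,_; proj₁; proj₂)
open import Data.Sum using (_⊎_; inj₁; inj₂)
open import Data.Empty using (⊥-elim)
open import Relation.Nullary using (¬_)
open import Relation.Binary.Definitions using (tri<; tri≈; tri>)
open import Relation.Binary.PropositionalEquality using (_≡_; refl; sym)

open DiaApp
open Branch

⊑-trans : ∀ {φ ψ χ} → φ ⊑ ψ → ψ ⊑ χ → φ ⊑ χ
⊑-trans p ⊑refl   = p
⊑-trans p (⊑~ q)  = ⊑~ (⊑-trans p q)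
⊑-trans p (⊑∧ˡ q) = ⊑∧ˡ (⊑-trans p q)
⊑-trans p (⊑∧ʳ q) = ⊑∧ʳ (⊑-trans p q)
⊑-trans p (⊑◇ q)  = ⊑◇ (⊑-trans p q)
⊑-trans p (⊑at q) = ⊑at (⊑-trans p q)

nom⊑⇒∈noms : ∀ {k ψ} → nom k ⊑ ψ → k ∈ noms ψ
nom⊑⇒∈noms ⊑refl               = here refl
nom⊑⇒∈noms (⊑~ p)              = nom⊑⇒∈noms p
nom⊑⇒∈noms (⊑∧ˡ p)             = ∈-++⁺ˡ (nom⊑⇒∈noms p)
nom⊑⇒∈noms (⊑∧ʳ {ψ = ψ} p)     = ∈-++⁺ʳ (noms ψ) (nom⊑⇒∈noms p)
nom⊑⇒∈noms (⊑◇ p)              = nom⊑⇒∈noms p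
nom⊑⇒∈noms (⊑at p)             = there (nom⊑⇒∈noms p)

module _ {r : AF} where

  step-⊆ : ∀ {Θ Θ'} → Step r Θ Θ' → fms Θ ⊆ fms Θ'
  step-⊆ (lin {cs} _) = ∈-++⁺ʳ cs
  step-⊆ (splitˡ _)   = there
  step-⊆ (splitʳ _)   = there
  step-⊆ (dia◇ _ _)   = λ f∈ → there (there f∈)

  reachable⇒root∈ : ∀ {Θ} → Reachable r Θ → r ∈ fms Θ
  reachable⇒root∈ start             = here refl
  reachable⇒root∈ (step R _ _ s)    = step-⊆ s (reachable⇒root∈ R)

  reachable⇒new∉root : ∀ {Θ d} → Reachable r Θ → d ∈ log Θ → new d ∉ afNoms r
  reachable⇒new∉root (step R _ _ (lin _))    d∈ = reachable⇒new∉root R d∈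
  reachable⇒new∉root (step R _ _ (splitˡ _)) d∈ = reachable⇒new∉root R d∈
  reachable⇒new∉root (step R _ _ (splitʳ _)) d∈ = reachable⇒new∉root R d∈
  reachable⇒new∉root (step R _ _ (dia◇ _ fresh)) (here refl) k∈r =
    fresh (r , reachable⇒root∈ R , k∈r)
  reachable⇒new∉root (step R _ _ (dia◇ _ _)) (there d∈) = reachable⇒new∉root R d∈

  saturated⇒lin∈ : ∀ {Θ f} → Saturated r Θ → Lin r Θ (f ∷ []) → f ∈ fms Θ
  saturated⇒lin∈ sat l = proj₁ sat l (here refl)

  twins-sym : ∀ {Θ x y} → Twins r Θ x y → Twins r Θ y x
  twins-sym t φ = proj₂ (t φ) , proj₁ (t φ)

  twins-trans : ∀ {Θ x y z} → Twins r Θ x y → Twins r Θ y z → Twins r Θ x z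
  twins-trans t u φ = (λ p → proj₁ (u φ) (proj₁ (t φ) p))
                    , (λ p → proj₂ (t φ) (proj₂ (u φ) p))

  earlier-trichotomy : ∀ {Θ a b m n} → Stage r Θ a m → Stage r Θ b n →
                       Earlier r Θ a b ⊎ a ≡ b ⊎ Earlier r Θ b a
  earlier-trichotomy {a = a} {b} {m} {n} sa sb with <-cmp m n
  ... | tri< m<n _ _ = inj₁ (m , n , sa , sb , inj₁ m<n)
  ... | tri> _ _ n<m = inj₂ (inj₂ (n , m , sb , sa , inj₁ n<m))
  ... | tri≈ _ m≡n _ with <-cmp a b
  ...   | tri< a<b _ _ = inj₁ (m , n , sa , sb , inj₂ (m≡n , a<b))
  ...   | tri≈ _ a≡b _ = inj₂ (inj₁ a≡b)
  ...   | tri> _ _ b<a = inj₂ (inj₂ (n , m , sb , sa , inj₂ (sym m≡n , b<a)))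

  idUrfather-twins-unique : ∀ {Θ i j a b} → Twins r Θ i j →
                            IsIdUrfather r Θ i a → IsIdUrfather r Θ j b → a ≡ b
  idUrfather-twins-unique {Θ} {i} {j} {a} {b} tij
    (_ , _ , (_ , sa) , tia , qa , earliestA) (_ , _ , (_ , sb) , tjb , qb , earliestB)
    with earlier-trichotomy {Θ} sa sb
  ... | inj₁ a<b        =
    ⊥-elim (earliestB a a<b (twins-trans {Θ} {j} {i} {a} (twins-sym {Θ} {i} {j} tij) tia , qa))
  ... | inj₂ (inj₁ a≡b) = a≡b
  ... | inj₂ (inj₂ b<a) = ⊥-elim (earliestA b b<a (twins-trans {Θ} {i} {j} {b} tij tjb , qb))

module _ {i₀ : Nom} {φ₀ : Fm} where

  private
    r : AF
    r = 𝕒⟨ i₀ ⟩ φ₀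

  acc⇒¬quasiSub : ∀ {Θ f} → Reachable r Θ → IsAcc Θ f → ¬ QuasiSub f r
  acc⇒¬quasiSub R (d , d∈ , _ , refl) (inj₁ ◇new⊑φ₀) =
    reachable⇒new∉root R d∈ (there (nom⊑⇒∈noms (⊑-trans (⊑◇ ⊑refl) ◇new⊑φ₀)))
  acc⇒¬quasiSub R (_ , _ , _ , refl) (inj₂ (_ , () , _))

  at-nom⇒InT⊆ : ∀ {Θ x y φ} → Reachable r Θ → Saturated r Θ →
                𝕒⟨ x ⟩ (nom y) ∈ fms Θ → InT r Θ x φ → InT r Θ y φ
  at-nom⇒InT⊆ R sat xy (xφ , q) =
    saturated⇒lin∈ sat (rId xφ xy (λ acc → acc⇒¬quasiSub R acc q)) , q

  at-nom-sym : ∀ {Θ x y} → Saturated r Θ →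
               𝕒⟨ x ⟩ (nom y) ∈ fms Θ → 𝕒⟨ y ⟩ (nom x) ∈ fms Θ
  at-nom-sym sat xy = saturated⇒lin∈ sat (rId xx xy λ { (_ , _ , _ , ()) })
    where xx = saturated⇒lin∈ sat (rRef (_ , xy , here refl))

  at-nom⇒twins : ∀ {Θ x y} → Reachable r Θ → Saturated r Θ →
                 𝕒⟨ x ⟩ (nom y) ∈ fms Θ → Twins r Θ x y
  at-nom⇒twins R sat xy φ =
    at-nom⇒InT⊆ R sat xy , at-nom⇒InT⊆ R sat (at-nom-sym sat xy)

lemma8 : ∀ (i₀ : Nom) (φ₀ : Fm) → i₀ ∉ noms φ₀ →
    ∀ (Θ : Branch) →
    Reachable (𝕒⟨ i₀ ⟩ φ₀) Θ →
    Saturated (𝕒⟨ i₀ ⟩ φ₀) Θ →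
    ∀ (i j : Nom) → 𝕒⟨ i ⟩ (nom j) ∈ Branch.fms Θ →
    ∀ (a b : Nom) →
    IsIdUrfather (𝕒⟨ i₀ ⟩ φ₀) Θ i a →
    IsIdUrfather (𝕒⟨ i₀ ⟩ φ₀) Θ j b →
    a ≡ b
lemma8 _ _ _ _ R sat _ _ ij _ _ = idUrfather-twins-unique (at-nom⇒twins R sat ij)
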